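{- Let $E$ be a finite set with a total order $\preceq$ and let $\mathcal{C}\subseteq 2^E$ be a clutter (no member contains another member). In the BDD $\mathsf{B}(\mathcal{C})$ with respect to $(E,\preceq)$, every 1-path traverses exactly $|E|$ non-terminal nodes.
   Context: A decision diagram over $(E,\preceq)$ is a directed acyclic graph with a unique root, at most two terminal nodes, the 0-terminal $\bot$ and the 1-terminal $\top$, and non-terminal nodes $\nu$, each with a label $\ell(\nu)\in E$ and exactly two outgoing arcs, the 0-arc $(\nu,\nu_0)$ and the 1-arc $(\nu,\nu_1)$, with $\ell(\nu)\prec\ell(\nu_0),\ell(\nu_1)$ (terminal labels regarded as larger than all elements of $E$). A 1-path is a directed path from the root to $\top$. The BDD $\mathsf{B}(\mathcal{S})$ of $\mathcal{S}\subseteq 2^E$ is the unique diagram obtained from the complete binary decision tree of $\mathcal{S}$ (internal nodes at depth $j$ labeled by the $(j+1)$-th smallest element of $E$; the leaf reached by taking 1-arcs exactly at the elements of $X$ is $\top$ iff $X\in\mathcal{S}$, else $\bot$) by exhaustively applying: (NS) merge non-terminal nodes with the same label, same 0-successor and same 1-successor; (B-ND) remove every non-terminal $\nu$ with $\nu_0=\nu_1$, redirecting arcs entering $\nu$ to $\nu_0$. -}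

module Defs where

open import Data.Nat using (ℕ; zero; suc)
open import Data.Nat.Properties using () renaming (_≟_ to _≟ℕ_)
open import Data.Bool using (Bool; true; false; if_then_else_)
open import Data.Vec using (Vec; []; _∷_)
open import Data.Fin.Subset using (Subset; _⊆_)
open import Relation.Binary.PropositionalEquality using (_≡_; refl; cong)
open import Relation.Nullary using (Dec; yes; no; ¬_)

-- Ground set E = {0 < 1 < … < n-1} (i.e. Fin n with its natural order);
-- a subset X ⊆ E is a 'Subset n' (Vec Bool n, position i = element i).
Family : ℕ → Set
Family n = Subset n → Bool

IsClutter : ∀ {n} → Family n → Set
IsClutter {n} 𝒞 = ∀ (X Y : Subset n) → 𝒞 X ≡ true → 𝒞 Y ≡ true → X ⊆ Y → X ≡ Y

-- Decision diagrams, unfolded into trees (a node label is the index of an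
-- element of E).  Root-to-terminal paths in a DAG correspond exactly to
-- root-to-leaf paths in its tree unfolding; NS-merging does not change the
-- unfolding, and two nodes of an NS-reduced diagram coincide iff their
-- unfoldings are equal.
data DD : Set where
  ⊥ᵈ ⊤ᵈ : DD
  node : ℕ → DD → DD → DD   -- node label 0-child 1-child

node-inj₁ : ∀ {a b c d e f} → node a b c ≡ node d e f → a ≡ d
node-inj₁ refl = refl
node-inj₂ : ∀ {a b c d e f} → node a b c ≡ node d e f → b ≡ e
node-inj₂ refl = refl
node-inj₃ : ∀ {a b c d e f} → node a b c ≡ node d e f → c ≡ f
node-inj₃ refl = refl

_≟DD_ : (s t : DD) → Dec (s ≡ t)
⊥ᵈ ≟DD ⊥ᵈ = yes refl
⊥ᵈ ≟DD ⊤ᵈ = no λ ()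
⊥ᵈ ≟DD node _ _ _ = no λ ()
⊤ᵈ ≟DD ⊥ᵈ = no λ ()
⊤ᵈ ≟DD ⊤ᵈ = yes refl
⊤ᵈ ≟DD node _ _ _ = no λ ()
node _ _ _ ≟DD ⊥ᵈ = no λ ()
node _ _ _ ≟DD ⊤ᵈ = no λ ()
node a b c ≟DD node d e f with a ≟ℕ d | b ≟DD e | c ≟DD f
... | yes refl | yes refl | yes refl = yes refl
... | no p | _ | _ = no λ q → p (node-inj₁ q)
... | yes _ | no p | _ = no λ q → p (node-inj₂ q)
... | yes _ | yes _ | no p = no λ q → p (node-inj₃ q)

decTree : ∀ k → ℕ → (Subset k → Bool) → DD
decTree zero    d f = if f [] then ⊤ᵈ else ⊥ᵈ
decTree (suc k) d f =
  node d (decTree k (suc d) (λ X → f (false ∷ X)))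
         (decTree k (suc d) (λ X → f (true ∷ X)))

-- Exhaustive application of (B-ND) (bottom-up; children already reduced,
-- equality of reduced sub-diagrams = same node after NS-merging).
reduce : DD → DD
reduce ⊥ᵈ = ⊥ᵈ
reduce ⊤ᵈ = ⊤ᵈ
reduce (node l t₀ t₁) with reduce t₀ ≟DD reduce t₁
... | yes _ = reduce t₀
... | no  _ = node l (reduce t₀) (reduce t₁)

BDD : ∀ n → Family n → DD
BDD n 𝒮 = reduce (decTree n 0 𝒮)

data OnePath : DD → Set where
  stop : OnePath ⊤ᵈ
  via0 : ∀ {l t₀ t₁} → OnePath t₀ → OnePath (node l t₀ t₁)
  via1 : ∀ {l t₀ t₁} → OnePath t₁ → OnePath (node l t₀ t₁)

nonTerminals : ∀ {t} → OnePath t → ℕ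
nonTerminals stop = 0
nonTerminals (via0 p) = suc (nonTerminals p)
nonTerminals (via1 p) = suc (nonTerminals p)

{-# OPTIONS --safe #-}
module Submission where

open import Defs
open import Data.Nat using (ℕ; zero; suc)
open import Data.Bool using (Bool; true; false; if_then_else_)
open import Data.Vec using ([]; _∷_)
open import Data.Vec.Properties using (∷-injectiveʳ)
open import Data.Fin.Subset using (Subset)
open import Data.Fin.Subset.Properties using (s⊆s; out⊆; ⊆-refl)
open import Data.Product using (∃; _,_)
open import Function using (_∘_)
open import Relation.Binary.PropositionalEquality
  using (_≡_; _≢_; refl; sym; trans; cong; module ≡-Reasoning)
open import Relation.Nullary using (yes; no; contradiction)

-- Reduction preserves the Boolean function a diagram computes, and the
-- decision tree of 𝒮 computes 𝒮; hence if (B-ND) removes the node for an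
-- element e, the two cofactors {X ⊆ E∖e : X ∈ 𝒮} and {X ⊆ E∖e : X+e ∈ 𝒮}
-- coincide.  A 1-path below that node yields a member X of the first
-- cofactor, so X and X+e both lie in 𝒮, which a clutter forbids.  So a
-- 1-path skips no level and traverses exactly |E| non-terminals.

⟦_⟧ : DD → (ℕ → Bool) → Bool
⟦ ⊥ᵈ ⟧         σ = false
⟦ ⊤ᵈ ⟧         σ = true
⟦ node l t₀ t₁ ⟧ σ = if σ l then ⟦ t₁ ⟧ σ else ⟦ t₀ ⟧ σ

reduce-sound : ∀ t σ → ⟦ reduce t ⟧ σ ≡ ⟦ t ⟧ σ
reduce-sound ⊥ᵈ σ = refl
reduce-sound ⊤ᵈ σ = refl
reduce-sound (node l t₀ t₁) σ with reduce t₀ ≟DD reduce t₁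
... | no _ with σ l
...   | false = reduce-sound t₀ σ
...   | true  = reduce-sound t₁ σ
reduce-sound (node l t₀ t₁) σ | yes t₀≡t₁ with σ l
...   | false = reduce-sound t₀ σ
...   | true  = trans (cong (λ t → ⟦ t ⟧ σ) t₀≡t₁) (reduce-sound t₁ σ)

window : ∀ k → ℕ → (ℕ → Bool) → Subset k
window zero    d σ = []
window (suc k) d σ = σ d ∷ window k (suc d) σ

window-suc : ∀ k d σ → window k (suc d) σ ≡ window k d (σ ∘ suc)
window-suc zero    d σ = refl
window-suc (suc k) d σ = cong (σ (suc d) ∷_) (window-suc k (suc d) σ)

-- X placed at the labels d, d+1, …, d+k-1, and false elsewhere.
place : ∀ {k} → ℕ → Subset k → ℕ → Bool
place zero    []      m       = false
place zero    (b ∷ X) zero    = b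
place zero    (b ∷ X) (suc m) = place zero X m
place (suc d) X       zero    = false
place (suc d) X       (suc m) = place d X m

window-place : ∀ {k} d (X : Subset k) → window k d (place d X) ≡ X
window-place zero    []      = refl
window-place zero    (b ∷ X) =
  cong (b ∷_) (trans (window-suc _ 0 (place 0 (b ∷ X))) (window-place 0 X))
window-place (suc d) X       =
  trans (window-suc _ d (place (suc d) X)) (window-place d X)

decTree-sound : ∀ k d f σ → ⟦ decTree k d f ⟧ σ ≡ f (window k d σ)
decTree-sound zero d f σ with f []
... | true  = refl
... | false = refl
decTree-sound (suc k) d f σ with σ d
... | true  = decTree-sound k (suc d) (λ X → f (true ∷ X)) σ
... | false = decTree-sound k (suc d) (λ X → f (false ∷ X)) σ

reduce-decTree-injective : ∀ k d (f g : Subset k → Bool) →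
  reduce (decTree k d f) ≡ reduce (decTree k d g) → ∀ X → f X ≡ g X
reduce-decTree-injective k d f g tf≡tg X = begin
  f X                                   ≡⟨ cong f (sym (window-place d X)) ⟩
  f (window k d σ)                      ≡⟨ sym (decTree-sound k d f σ) ⟩
  ⟦ decTree k d f ⟧ σ                   ≡⟨ sym (reduce-sound (decTree k d f) σ) ⟩
  ⟦ reduce (decTree k d f) ⟧ σ          ≡⟨ cong (λ t → ⟦ t ⟧ σ) tf≡tg ⟩
  ⟦ reduce (decTree k d g) ⟧ σ          ≡⟨ reduce-sound (decTree k d g) σ ⟩
  ⟦ decTree k d g ⟧ σ                   ≡⟨ decTree-sound k d g σ ⟩
  g (window k d σ)                      ≡⟨ cong g (window-place d X) ⟩
  g X                                   ∎
  where
  open ≡-Reasoning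
  σ : ℕ → Bool
  σ = place d X

onePath⇒member : ∀ k d f → OnePath (reduce (decTree k d f)) → ∃ λ X → f X ≡ true
onePath⇒member zero d f p with f [] in f[]≡true
... | true  = [] , f[]≡true
onePath⇒member zero d f () | false
onePath⇒member (suc k) d f p
  with reduce (decTree k (suc d) (λ X → f (false ∷ X)))
       ≟DD reduce (decTree k (suc d) (λ X → f (true ∷ X)))
... | yes _ with onePath⇒member k (suc d) (λ X → f (false ∷ X)) p
...   | X , fX = false ∷ X , fX
onePath⇒member (suc k) d f (via0 p) | no _
  with onePath⇒member k (suc d) (λ X → f (false ∷ X)) p
... | X , fX = false ∷ X , fX
onePath⇒member (suc k) d f (via1 p) | no _
  with onePath⇒member k (suc d) (λ X → f (true ∷ X)) p
... | X , fX = true ∷ X , fX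

clutter-cofactor : ∀ {k} {f : Family (suc k)} b → IsClutter f → IsClutter (λ X → f (b ∷ X))
clutter-cofactor b cl X Y fX fY X⊆Y = ∷-injectiveʳ (cl (b ∷ X) (b ∷ Y) fX fY (s⊆s X⊆Y))

clutter⇒cofactors-disjoint : ∀ {k} {f : Family (suc k)} → IsClutter f →
  ∀ X → f (false ∷ X) ≡ true → f (true ∷ X) ≢ true
clutter⇒cofactors-disjoint cl X f₀X f₁X with cl (false ∷ X) (true ∷ X) f₀X f₁X (out⊆ ⊆-refl)
... | ()

nonTerminals-clutter : ∀ k d (f : Family k) → IsClutter f →
  (p : OnePath (reduce (decTree k d f))) → nonTerminals p ≡ k
nonTerminals-clutter zero d f cl p with f []
nonTerminals-clutter zero d f cl stop | true = refl
nonTerminals-clutter zero d f cl ()   | false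
nonTerminals-clutter (suc k) d f cl p
  with reduce (decTree k (suc d) (λ X → f (false ∷ X)))
       ≟DD reduce (decTree k (suc d) (λ X → f (true ∷ X)))
... | yes t₀≡t₁ with onePath⇒member k (suc d) (λ X → f (false ∷ X)) p
...   | X , f₀X = contradiction f₁X (clutter⇒cofactors-disjoint cl X f₀X)
  where
  f₁X : f (true ∷ X) ≡ true
  f₁X = trans (sym (reduce-decTree-injective k (suc d) _ _ t₀≡t₁ X)) f₀X
nonTerminals-clutter (suc k) d f cl (via0 p) | no _ =
  cong suc (nonTerminals-clutter k (suc d) _ (clutter-cofactor false cl) p)
nonTerminals-clutter (suc k) d f cl (via1 p) | no _ =
  cong suc (nonTerminals-clutter k (suc d) _ (clutter-cofactor true cl) p)

lemma3p1 : (n : ℕ) (𝒞 : Family n) → IsClutter 𝒞 →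
           (p : OnePath (BDD n 𝒞)) → nonTerminals p ≡ n
lemma3p1 n 𝒞 = nonTerminals-clutter n 0 𝒞
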